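{- Let $a\in\mathbb{Z}_{+}$ and $X,Y,L,R\in\Sigma^*$. If $|L|,|R|\ge|Y|$ and no character occurring in $Y$ occurs in $LR$, then $D^+_a(X,Y)=D_a(LXR,Y)$.
   Context: For $a\ge1$, $\mathtt{ED}_a(X,Y)$ denotes the minimum total cost of a sequence of edit operations transforming $X$ into $Y$, where insertions and deletions cost $1$ and substitutions cost $\frac1a$. For strings $X,Y$, $D_a(X,Y)=\mathtt{ED}_a(X,Y)+|Y|-|X|$, and $D^+_a(X,Y)=D_a(\$^{|Y|}\cdot X\cdot\$^{|Y|},Y)$, where $\$\notin\Sigma$ is a fresh character and $\$^m$ denotes $m$ copies of $\$$. -}

module Defs where

open import Data.Nat using (ℕ; NonZero)
open import Data.Integer using (+_)
open import Data.List using (List; []; _∷_; _++_; length; replicate; map)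
open import Data.Maybe using (Maybe; just; nothing)
open import Data.Product using (Σ; _×_)
open import Data.Rational using (ℚ; 0ℚ; 1ℚ; _+_; _-_; _/_; _≤_)
open import Relation.Binary.PropositionalEquality using (_≡_)

data Step {A : Set} (a : ℕ) .{{_ : NonZero a}} : List A → List A → ℚ → Set where
  ins : ∀ (u v : List A) (c : A) → Step a (u ++ v) (u ++ c ∷ v) 1ℚ
  del : ∀ (u v : List A) (c : A) → Step a (u ++ c ∷ v) (u ++ v) 1ℚ
  sub : ∀ (u v : List A) (c d : A) → Step a (u ++ c ∷ v) (u ++ d ∷ v) (+ 1 / a)

data Edits {A : Set} (a : ℕ) .{{_ : NonZero a}} : List A → List A → ℚ → Set where
  done : ∀ X → Edits a X X 0ℚ
  step : ∀ {X Y Z c d} → Step a X Y c → Edits a Y Z d → Edits a X Z (c + d)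

IsED : {A : Set} (a : ℕ) .{{_ : NonZero a}} → List A → List A → ℚ → Set
IsED a X Y e = Edits a X Y e × (∀ c → Edits a X Y c → e ≤ c)

len : {A : Set} → List A → ℚ
len X = + length X / 1

Dval : {A : Set} → List A → List A → ℚ → ℚ
Dval X Y e = e + len Y - len X

-- The alphabet extended with a fresh character $ (= nothing).
pad : {A : Set} → List A → List A → List (Maybe A)
pad X Y = replicate (length Y) nothing ++ map just X ++ replicate (length Y) nothing

-- Edit sequences normalise into alignments, of cost n + m/a for n insertions/deletions and
-- m substitutions, and an alignment of a concatenation splits into alignments of the pieces.
-- A side block sharing no character with the part T of the target aligned to it has no matches,
-- so n + 2m = |side| + |T| and m ≤ |T|; replacing it by any block of length ≥ |T| therefore keeps
-- m and shifts n by exactly the change in source length. Hence ED_a(S, T) - |S| is the same for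
-- the sources $^|Y| X $^|Y| and L X R.
module Submission where

open import Defs
open import Data.Nat using (ℕ; NonZero; _≥_; zero; suc)
import Data.Nat as Nat
open import Data.List using (List; []; _∷_; length; _++_; map; replicate)
open import Data.Maybe using (just; nothing)
open import Data.List.Membership.Propositional using (_∈_; _∉_)
open import Data.Rational using (ℚ)
open import Data.List.Properties
  using (∷-injective; ∷-injectiveʳ; map-++; length-map; length-++; length-++-≤ˡ; length-++-≤ʳ; length-replicate)
open import Data.List.Relation.Binary.Disjoint.Propositional using (Disjoint)
open import Data.List.Relation.Unary.Any using (here; there)
open import Data.List.Relation.Unary.All using (lookup)
open import Data.List.Relation.Unary.All.Properties using (replicate⁺)
open import Data.List.Membership.Propositional.Properties using (∈-map⁻; ∈-++⁺ˡ; ∈-++⁺ʳ)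
open import Data.Maybe.Properties using (just-injective)
open import Data.Product using (∃; ∃₂; _×_; _,_)
open import Function.Definitions using (Injective)
open import Relation.Binary.PropositionalEquality
  using (_≡_; refl; sym; trans; cong; cong₂; subst; subst₂; module ≡-Reasoning)

private variable
  A B : Set
  S T S′ T′ P Q P₁ P₂ : List A
  n m : ℕ
  c e e′ : ℚ

data Alignment {A : Set} : List A → List A → ℕ → ℕ → Set where
  []         : Alignment [] [] 0 0
  delete     : ∀ x → Alignment S T n m → Alignment (x ∷ S) T (suc n) m
  insert     : ∀ y → Alignment S T n m → Alignment S (y ∷ T) (suc n) m
  substitute : ∀ x y → Alignment S T n m → Alignment (x ∷ S) (y ∷ T) n (suc m)
  match      : ∀ x → Alignment S T n m → Alignment (x ∷ S) (x ∷ T) n m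

module _ where
  open import Data.Nat using (_+_; _≤_; z≤n; s≤s)
  open import Data.Nat.Properties
    using (≤-refl; ≤-reflexive; ≤-trans; n≤1+n; m≤n⇒m≤1+n; +-suc; +-assoc; +-cancelˡ-≡)
  open import Data.Nat.Tactic.RingSolver using (solve-∀)

  record Alignment≤ (S T : List A) (n m : ℕ) : Set where
    constructor within
    field
      {n′ m′}   : ℕ
      alignment : Alignment S T n′ m′
      n′≤n      : n′ ≤ n
      m′≤m      : m′ ≤ m

  delete≤ : ∀ x → Alignment≤ S T n m → Alignment≤ (x ∷ S) T (suc n) m
  delete≤ x (within al p q) = within (delete x al) (s≤s p) q

  insert≤ : ∀ y → Alignment≤ S T n m → Alignment≤ S (y ∷ T) (suc n) m
  insert≤ y (within al p q) = within (insert y al) (s≤s p) q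

  substitute≤ : ∀ x y → Alignment≤ S T n m → Alignment≤ (x ∷ S) (y ∷ T) n (suc m)
  substitute≤ x y (within al p q) = within (substitute x y al) p (s≤s q)

  match≤ : ∀ x → Alignment≤ S T n m → Alignment≤ (x ∷ S) (x ∷ T) n m
  match≤ x (within al p q) = within (match x al) p q

  matchAll : ∀ (S : List A) → Alignment S S 0 0
  matchAll []      = []
  matchAll (x ∷ S) = match x (matchAll S)

  delete-at : ∀ (u v : List A) x → Alignment (u ++ v) T n m → Alignment (u ++ x ∷ v) T (suc n) m
  delete-at []      v x al                    = delete x al
  delete-at (w ∷ u) v x (delete .w al)       = delete w (delete-at u v x al)
  delete-at (w ∷ u) v x (insert y al)        = insert y (delete-at (w ∷ u) v x al)
  delete-at (w ∷ u) v x (substitute .w y al) = substitute w y (delete-at u v x al)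
  delete-at (w ∷ u) v x (match .w al)        = match w (delete-at u v x al)

  remove-at : ∀ (u v : List A) x →
              Alignment (u ++ x ∷ v) T n m → Alignment≤ (u ++ v) T (suc n) m
  remove-at []      v x (delete .x al)       = within al (m≤n⇒m≤1+n (n≤1+n _)) ≤-refl
  remove-at []      v x (insert y al)        = insert≤ y (remove-at [] v x al)
  remove-at []      v x (substitute .x y al) = within (insert y al) ≤-refl (n≤1+n _)
  remove-at []      v x (match .x al)        = within (insert x al) ≤-refl ≤-refl
  remove-at (w ∷ u) v x (delete .w al)       = delete≤ w (remove-at u v x al)
  remove-at (w ∷ u) v x (insert y al)        = insert≤ y (remove-at (w ∷ u) v x al)
  remove-at (w ∷ u) v x (substitute .w y al) = substitute≤ w y (remove-at u v x al)
  remove-at (w ∷ u) v x (match .w al)        = match≤ w (remove-at u v x al)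

  replace-at : ∀ (u v : List A) c d →
               Alignment (u ++ d ∷ v) T n m → Alignment≤ (u ++ c ∷ v) T n (suc m)
  replace-at []      v c d (delete .d al)       = within (delete c al) ≤-refl (n≤1+n _)
  replace-at []      v c d (insert y al)        = insert≤ y (replace-at [] v c d al)
  replace-at []      v c d (substitute .d y al) = within (substitute c y al) ≤-refl (n≤1+n _)
  replace-at []      v c d (match .d al)        = within (substitute c d al) ≤-refl ≤-refl
  replace-at (w ∷ u) v c d (delete .w al)       = delete≤ w (replace-at u v c d al)
  replace-at (w ∷ u) v c d (insert y al)        = insert≤ y (replace-at (w ∷ u) v c d al)
  replace-at (w ∷ u) v c d (substitute .w y al) = substitute≤ w y (replace-at u v c d al)
  replace-at (w ∷ u) v c d (match .w al)        = match≤ w (replace-at u v c d al)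

  _++ᴬ_ : ∀ {T₁ T₂ n₁ m₁ n₂ m₂} → Alignment P T₁ n₁ m₁ → Alignment Q T₂ n₂ m₂ →
          Alignment (P ++ Q) (T₁ ++ T₂) (n₁ + n₂) (m₁ + m₂)
  []                 ++ᴬ b = b
  delete x a         ++ᴬ b = delete x (a ++ᴬ b)
  insert y a         ++ᴬ b = insert y (a ++ᴬ b)
  substitute x y a   ++ᴬ b = substitute x y (a ++ᴬ b)
  match x a          ++ᴬ b = match x (a ++ᴬ b)

  record Split (P Q T : List A) (n m : ℕ) : Set where
    constructor split-as
    field
      T₁ T₂            : List A
      {n₁ m₁ n₂ m₂}    : ℕ
      T≡T₁++T₂         : T ≡ T₁ ++ T₂
      left             : Alignment P T₁ n₁ m₁
      right            : Alignment Q T₂ n₂ m₂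
      n≡n₁+n₂          : n ≡ n₁ + n₂
      m≡m₁+m₂          : m ≡ m₁ + m₂

  split : ∀ (P : List A) → Alignment (P ++ Q) T n m → Split P Q T n m
  split [] al = split-as [] _ refl [] al refl refl
  split (x ∷ P) (delete .x al)
    with split-as T₁ T₂ refl a b refl refl ← split P al = split-as T₁ T₂ refl (delete x a) b refl refl
  split (x ∷ P) (insert y al)
    with split-as T₁ T₂ refl a b refl refl ← split (x ∷ P) al = split-as (y ∷ T₁) T₂ refl (insert y a) b refl refl
  split (x ∷ P) (substitute .x y al)
    with split-as T₁ T₂ refl a b refl refl ← split P al = split-as (y ∷ T₁) T₂ refl (substitute x y a) b refl refl
  split (x ∷ P) (match .x al)
    with split-as T₁ T₂ refl a b refl refl ← split P al = split-as (x ∷ T₁) T₂ refl (match x a) b refl refl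

  map⁺ : ∀ (f : A → B) → Alignment S T n m → Alignment (map f S) (map f T) n m
  map⁺ f []                 = []
  map⁺ f (delete x al)       = delete (f x) (map⁺ f al)
  map⁺ f (insert y al)       = insert (f y) (map⁺ f al)
  map⁺ f (substitute x y al) = substitute (f x) (f y) (map⁺ f al)
  map⁺ f (match x al)        = match (f x) (map⁺ f al)

  -- The images are passed as equations so that the recursion is on the alignment itself.
  map⁻ : ∀ {f : A → B} → Injective _≡_ _≡_ f → ∀ {S′ T′} → Alignment S′ T′ n m →
         (S T : List A) → S′ ≡ map f S → T′ ≡ map f T → Alignment S T n m
  map⁻ inj []                 []      []      _  _  = []
  map⁻ inj (delete x al)       (s ∷ S) T       eS eT = delete s (map⁻ inj al S T (∷-injectiveʳ eS) eT)
  map⁻ inj (insert y al)       S       (t ∷ T) eS eT = insert t (map⁻ inj al S T eS (∷-injectiveʳ eT))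
  map⁻ inj (substitute x y al) (s ∷ S) (t ∷ T) eS eT =
    substitute s t (map⁻ inj al S T (∷-injectiveʳ eS) (∷-injectiveʳ eT))
  map⁻ inj (match x al)        (s ∷ S) (t ∷ T) eS eT with ∷-injective eS | ∷-injective eT
  ... | refl , eS′ | fs≡ft , eT′ with inj fs≡ft
  ... | refl = match s (map⁻ inj al S T eS′ eT′)

  insertAll : ∀ (T : List A) → Alignment [] T (length T) 0
  insertAll []      = []
  insertAll (y ∷ T) = insert y (insertAll T)

  deleteAll : ∀ (S T : List A) → Alignment S T (length S + length T) 0
  deleteAll []      T = insertAll T
  deleteAll (x ∷ S) T = delete x (deleteAll S T)

  private
    substitution-count : ∀ m n {s t} → m + m + n ≡ s + t → suc m + suc m + n ≡ suc s + suc t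
    substitution-count m n {s} {t} e =
      cong suc (trans (cong (_+ n) (+-suc m m)) (trans (cong suc e) (sym (+-suc s t))))

  -- Without matches every character of S and of T is either aligned by a substitution or
  -- inserted/deleted.
  disjoint-alignment-count : Disjoint S T → Alignment S T n m →
                             m + m + n ≡ length S + length T × m ≤ length S × m ≤ length T
  disjoint-alignment-count d [] = refl , z≤n , z≤n
  disjoint-alignment-count {n = suc n} {m} d (delete x al)
    with e , m≤S , m≤T ← disjoint-alignment-count (λ (v∈S , v∈T) → d (there v∈S , v∈T)) al
    = trans (+-suc (m + m) n) (cong suc e) , m≤n⇒m≤1+n m≤S , m≤T
  disjoint-alignment-count {S = S} {n = suc n} {m} d (insert {T = T} y al)
    with e , m≤S , m≤T ← disjoint-alignment-count (λ (v∈S , v∈T) → d (v∈S , there v∈T)) al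
    = trans (+-suc (m + m) n) (trans (cong suc e) (sym (+-suc (length S) (length T)))) ,
      m≤S , m≤n⇒m≤1+n m≤T
  disjoint-alignment-count {n = n} {suc m} d (substitute x y al)
    with e , m≤S , m≤T ← disjoint-alignment-count (λ (v∈S , v∈T) → d (there v∈S , there v∈T)) al
    = substitution-count m n e , s≤s m≤S , s≤s m≤T
  disjoint-alignment-count d (match x al) with () ← d (here refl , here refl)

  alignment-with-substitutions : ∀ (S T : List A) m → m ≤ length S → m ≤ length T →
                                 ∃ λ n → Alignment S T n m × m + m + n ≡ length S + length T
  alignment-with-substitutions S T zero _ _ = _ , deleteAll S T , refl
  alignment-with-substitutions (x ∷ S) (y ∷ T) (suc m) (s≤s m≤S) (s≤s m≤T)
    with n , al , e ← alignment-with-substitutions S T m m≤S m≤T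
    = n , substitute x y al , substitution-count m n e

  realign-disjoint : ∀ (P′ : List A) → Disjoint P T → length T ≤ length P′ → Alignment P T n m →
                     ∃ λ n′ → Alignment P′ T n′ m × n + length P′ ≡ n′ + length P
  realign-disjoint {P = P} {T} {n} {m} P′ d T≤P′ al
    with e , _ , m≤T ← disjoint-alignment-count d al
    with n′ , al′ , e′ ← alignment-with-substitutions P′ T m (≤-trans m≤T T≤P′) m≤T
    = n′ , al′ , +-cancelˡ-≡ (m + m) _ _ (begin
        m + m + (n + length P′)          ≡⟨ +-assoc (m + m) n _ ⟨
        m + m + n + length P′            ≡⟨ cong (_+ length P′) e ⟩
        length P + length T + length P′  ≡⟨ swap (length P) (length T) (length P′) ⟩
        length P′ + length T + length P  ≡⟨ cong (_+ length P) e′ ⟨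
        m + m + n′ + length P            ≡⟨ +-assoc (m + m) n′ _ ⟩
        m + m + (n′ + length P)          ∎)
    where
    open ≡-Reasoning
    swap : ∀ p t q → p + t + q ≡ q + t + p
    swap = solve-∀

  private
    length-++₃ : ∀ (P Q R : List A) → length (P ++ Q ++ R) ≡ length P + (length Q + length R)
    length-++₃ P Q R = trans (length-++ P) (cong (length P +_) (length-++ Q))

    shift-sum : ∀ a a′ b c c′ p p′ q r r′ → a + p′ ≡ a′ + p → c + r′ ≡ c′ + r →
                a + (b + c) + (p′ + (q + r′)) ≡ a′ + (b + c′) + (p + (q + r))
    shift-sum a a′ b c c′ p p′ q r r′ e₁ e₂ = begin
      a + (b + c) + (p′ + (q + r′))   ≡⟨ regroup a b c p′ q r′ ⟩
      a + p′ + (b + q) + (c + r′)     ≡⟨ cong₂ (λ x z → x + (b + q) + z) e₁ e₂ ⟩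
      a′ + p + (b + q) + (c′ + r)     ≡⟨ regroup a′ b c′ p q r ⟨
      a′ + (b + c′) + (p + (q + r))   ∎
      where
      open ≡-Reasoning
      regroup : ∀ a b c p q r → a + (b + c) + (p + (q + r)) ≡ a + p + (b + q) + (c + r)
      regroup = solve-∀

  reframe : ∀ (P₁′ P₂′ : List A) → Disjoint P₁ T → Disjoint P₂ T →
            length T ≤ length P₁′ → length T ≤ length P₂′ → Alignment (P₁ ++ Q ++ P₂) T n m →
            ∃ λ n′ → Alignment (P₁′ ++ Q ++ P₂′) T n′ m ×
                     n + length (P₁′ ++ Q ++ P₂′) ≡ n′ + length (P₁ ++ Q ++ P₂)
  reframe {P₁ = P₁} {P₂ = P₂} {Q = Q} P₁′ P₂′ d₁ d₂ T≤P₁′ T≤P₂′ al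
    with split-as T₁ _ {n₁ = n₁} refl a₁ a₂₃ refl refl ← split P₁ al
    with split-as T₂ T₃ {n₁ = n₂} {n₂ = n₃} refl a₂ a₃ refl refl ← split Q a₂₃
    with n₁′ , a₁′ , e₁ ← realign-disjoint P₁′ (λ (v∈P , v∈T) → d₁ (v∈P , ∈-++⁺ˡ v∈T))
                            (≤-trans (length-++-≤ˡ T₁) T≤P₁′) a₁
    with n₃′ , a₃′ , e₃ ← realign-disjoint P₂′ (λ (v∈P , v∈T) → d₂ (v∈P , ∈-++⁺ʳ T₁ (∈-++⁺ʳ T₂ v∈T)))
                            (≤-trans (length-++-≤ʳ T₃ {T₂})
                              (≤-trans (length-++-≤ʳ (T₂ ++ T₃) {T₁}) T≤P₂′)) a₃
    = _ , a₁′ ++ᴬ (a₂ ++ᴬ a₃′) ,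
      trans (cong (_ +_) (length-++₃ P₁′ Q P₂′))
        (trans (shift-sum n₁ n₁′ n₂ n₃ n₃′ (length P₁) (length P₁′) (length Q) (length P₂) (length P₂′)
                          e₁ e₃)
          (cong (_ +_) (sym (length-++₃ P₁ Q P₂))))

  map-disjoint : ∀ {f : A → B} → Injective _≡_ _≡_ f → Disjoint P T → Disjoint (map f P) (map f T)
  map-disjoint inj d (v∈fP , v∈fT)
    with x , x∈P , refl ← ∈-map⁻ _ v∈fP
    with y , y∈T , fx≡fy ← ∈-map⁻ _ v∈fT
    = d (x∈P , subst (_∈ _) (sym (inj fx≡fy)) y∈T)

  padding-disjoint : ∀ k (Y : List A) → Disjoint (replicate k nothing) (map just Y)
  padding-disjoint k Y (v∈pad , v∈Y) = lookup (replicate⁺ {P = _∉ map just Y} k nothing∉Y) v∈pad v∈Y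
    where
    nothing∉Y : nothing ∉ map just Y
    nothing∉Y p with _ , _ , () ← ∈-map⁻ just p

  private
    map-++₃ : ∀ (f : A → B) P Q R → map f (P ++ Q ++ R) ≡ map f P ++ map f Q ++ map f R
    map-++₃ f P Q R = trans (map-++ f P _) (cong (map f P ++_) (map-++ f Q R))

    length-map-++₃ : ∀ (f : A → B) P Q R → length (map f P ++ map f Q ++ map f R) ≡ length (P ++ Q ++ R)
    length-map-++₃ f P Q R = trans (cong length (sym (map-++₃ f P Q R))) (length-map f (P ++ Q ++ R))

    Y≤padding : ∀ (Y : List A) → length (map just Y) ≤ length (replicate (length Y) (nothing {A = A}))
    Y≤padding Y = ≤-reflexive (trans (length-map just Y) (sym (length-replicate _)))

  pad→frame : ∀ (X Y L R : List A) → length Y ≤ length L → length Y ≤ length R →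
              Alignment (pad X Y) (map just Y) n m →
              ∃ λ n′ → Alignment (L ++ X ++ R) Y n′ m ×
                       n + length (L ++ X ++ R) ≡ n′ + length (pad X Y)
  pad→frame {n = n} X Y L R Y≤L Y≤R al
    with n′ , al′ , e ← reframe (map just L) (map just R)
                                (padding-disjoint (length Y) Y) (padding-disjoint (length Y) Y)
                                (subst₂ _≤_ (sym (length-map just Y)) (sym (length-map just L)) Y≤L)
                                (subst₂ _≤_ (sym (length-map just Y)) (sym (length-map just R)) Y≤R) al
    = n′ , map⁻ just-injective al′ (L ++ X ++ R) Y (sym (map-++₃ just L X R)) refl ,
      trans (cong (n +_) (sym (length-map-++₃ just L X R))) e

  frame→pad : ∀ (X Y L R : List A) → Disjoint L Y → Disjoint R Y →
              Alignment (L ++ X ++ R) Y n m →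
              ∃ λ n′ → Alignment (pad X Y) (map just Y) n′ m ×
                       n + length (pad X Y) ≡ n′ + length (L ++ X ++ R)
  frame→pad {n = n} {m} X Y L R dL dR al
    with n′ , al′ , e ← reframe (replicate (length Y) nothing) (replicate (length Y) nothing)
                                (map-disjoint just-injective dL) (map-disjoint just-injective dR)
                                (Y≤padding Y) (Y≤padding Y)
                                (subst (λ S → Alignment S (map just Y) n m) (map-++₃ just L X R) (map⁺ just al))
    = n′ , al′ , trans e (cong (n′ +_) (length-map-++₃ just L X R))

module _ where
  open import Data.Integer using (+_)
  import Data.Integer as ℤ
  import Data.Integer.Properties as ℤ
  open import Data.Nat.Properties using (m+[n∸m]≡n)
  open import Data.Rational using (_+_; _≤_; _/_; 0ℚ; toℚᵘ)
  open import Data.Rational.Properties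
    using (fromℚᵘ-cong; fromℚᵘ-toℚᵘ; toℚᵘ-fromℚᵘ; toℚᵘ-homo-+; normalize-nonNeg; nonNegative⁻¹;
           +-monoʳ-≤; +-identityʳ; module ≤-Reasoning)
  open import Data.Rational.Unnormalised using (mkℚᵘ; *≡*; _≃_)
  import Data.Rational.Unnormalised.Properties as ℚᵘ

  fromℕ : ℕ → ℚ
  fromℕ n = + n / 1

  fromℕ-+ : ∀ m n → fromℕ (m Nat.+ n) ≡ fromℕ m + fromℕ n
  fromℕ-+ m n = trans (fromℚᵘ-cong toℚᵘ-sum) (fromℚᵘ-toℚᵘ _)
    where
    toℚᵘ-sum : mkℚᵘ (+ (m Nat.+ n)) 0 ≃ toℚᵘ (fromℕ m + fromℕ n)
    toℚᵘ-sum = ℚᵘ.≃-trans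
      (*≡* (cong (ℤ._* (+ 1)) (trans (ℤ.pos-+ m n)
             (sym (cong₂ ℤ._+_ (ℤ.*-identityʳ (+ m)) (ℤ.*-identityʳ (+ n)))))))
      (ℚᵘ.≃-sym (ℚᵘ.≃-trans (toℚᵘ-homo-+ (fromℕ m) (fromℕ n))
                            (ℚᵘ.+-cong (toℚᵘ-fromℚᵘ (mkℚᵘ (+ m) 0)) (toℚᵘ-fromℚᵘ (mkℚᵘ (+ n) 0)))))

  fromℕ-mono-≤ : ∀ {m n} → m Nat.≤ n → fromℕ m ≤ fromℕ n
  fromℕ-mono-≤ {m} {n} m≤n = begin
    fromℕ m                        ≡⟨ +-identityʳ (fromℕ m) ⟨
    fromℕ m + 0ℚ                   ≤⟨ +-monoʳ-≤ (fromℕ m) (nonNegative⁻¹ _ {{normalize-nonNeg (n Nat.∸ m) 1}}) ⟩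
    fromℕ m + fromℕ (n Nat.∸ m)    ≡⟨ fromℕ-+ m (n Nat.∸ m) ⟨
    fromℕ (m Nat.+ (n Nat.∸ m))    ≡⟨ cong fromℕ (m+[n∸m]≡n m≤n) ⟩
    fromℕ n                        ∎
    where open ≤-Reasoning

module _ (a : ℕ) .{{_ : NonZero a}} where
  open import Data.Integer using (+_)
  open import Data.Rational using (_+_; _*_; _≤_; _/_; 0ℚ; 1ℚ)
  open import Data.Rational.Properties
    using (normalize-nonNeg; ≤-reflexive; ≤-trans; +-mono-≤; +-monoʳ-≤; +-monoˡ-≤;
           *-monoʳ-≤-nonNeg; +-identityˡ; *-zeroˡ; module ≤-Reasoning)
  open import Data.Rational.Solver using (module +-*-Solver)
  open +-*-Solver

  substitutionCost : ℚ
  substitutionCost = + 1 / a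

  cost : ℕ → ℕ → ℚ
  cost n m = fromℕ n + fromℕ m * substitutionCost

  cost-0 : cost 0 0 ≡ 0ℚ
  cost-0 = trans (+-identityˡ _) (*-zeroˡ substitutionCost)

  cost-sucˡ : ∀ n m → cost (suc n) m ≡ 1ℚ + cost n m
  cost-sucˡ n m = trans (cong (_+ fromℕ m * substitutionCost) (fromℕ-+ 1 n))
    (solve 3 (λ N M h → (con 1ℚ :+ N) :+ M :* h := con 1ℚ :+ (N :+ M :* h))
           refl (fromℕ n) (fromℕ m) substitutionCost)

  cost-sucʳ : ∀ n m → cost n (suc m) ≡ substitutionCost + cost n m
  cost-sucʳ n m = trans (cong (λ M → fromℕ n + M * substitutionCost) (fromℕ-+ 1 m))
    (solve 3 (λ N M h → N :+ (con 1ℚ :+ M) :* h := h :+ (N :+ M :* h))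
           refl (fromℕ n) (fromℕ m) substitutionCost)

  cost-+ˡ : ∀ n k m → cost (n Nat.+ k) m ≡ cost n m + fromℕ k
  cost-+ˡ n k m = trans (cong (_+ fromℕ m * substitutionCost) (fromℕ-+ n k))
    (solve 4 (λ N K M h → (N :+ K) :+ M :* h := (N :+ M :* h) :+ K)
           refl (fromℕ n) (fromℕ k) (fromℕ m) substitutionCost)

  cost-mono-≤ : ∀ {n′ m′ n m} → n′ Nat.≤ n → m′ Nat.≤ m → cost n′ m′ ≤ cost n m
  cost-mono-≤ p q =
    +-mono-≤ (fromℕ-mono-≤ p) (*-monoʳ-≤-nonNeg substitutionCost {{normalize-nonNeg 1 a}} (fromℕ-mono-≤ q))

  ∷-edits : ∀ x → Edits a S T c → Edits a (x ∷ S) (x ∷ T) c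
  ∷-edits x (done S)                  = done (x ∷ S)
  ∷-edits x (step (ins u v y) es)     = step (ins (x ∷ u) v y) (∷-edits x es)
  ∷-edits x (step (del u v y) es)     = step (del (x ∷ u) v y) (∷-edits x es)
  ∷-edits x (step (sub u v y z) es)   = step (sub (x ∷ u) v y z) (∷-edits x es)

  alignment⇒edits : Alignment S T n m → ∃ λ c → Edits a S T c × c ≡ cost n m
  alignment⇒edits [] = _ , done [] , sym cost-0
  alignment⇒edits (delete {S = S} {n = n} {m} x al) with c , es , refl ← alignment⇒edits al =
    _ , step (del [] S x) es , sym (cost-sucˡ n m)
  alignment⇒edits (insert {S = S} {n = n} {m} y al) with c , es , refl ← alignment⇒edits al =
    _ , step (ins [] S y) (∷-edits y es) , sym (cost-sucˡ n m)
  alignment⇒edits (substitute {S = S} {n = n} {m} x y al) with c , es , refl ← alignment⇒edits al =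
    _ , step (sub [] S x y) (∷-edits y es) , sym (cost-sucʳ n m)
  alignment⇒edits (match x al) with c , es , refl ← alignment⇒edits al =
    _ , ∷-edits x es , refl

  CheapAlignment : List A → List A → ℚ → Set
  CheapAlignment S T c = ∃₂ λ n m → Alignment S T n m × cost n m ≤ c

  private
    cheap : Alignment≤ S T n m → cost n m ≤ c → CheapAlignment S T c
    cheap (within al p q) le = _ , _ , al , ≤-trans (cost-mono-≤ p q) le

  edits⇒alignment : Edits a S T c → CheapAlignment S T c
  edits⇒alignment (done S) = 0 , 0 , matchAll S , ≤-reflexive cost-0
  edits⇒alignment (step (ins u v x) es) with n , m , al , le ← edits⇒alignment es =
    cheap (remove-at u v x al) (subst (_≤ _) (sym (cost-sucˡ n m)) (+-monoʳ-≤ 1ℚ le))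
  edits⇒alignment (step (del u v x) es) with n , m , al , le ← edits⇒alignment es =
    _ , _ , delete-at u v x al , subst (_≤ _) (sym (cost-sucˡ n m)) (+-monoʳ-≤ 1ℚ le)
  edits⇒alignment (step (sub u v x y) es) with n , m , al , le ← edits⇒alignment es =
    cheap (replace-at u v x y al) (subst (_≤ _) (sym (cost-sucʳ n m)) (+-monoʳ-≤ substitutionCost le))

  ED≤cost : IsED a S T e → Alignment S T n m → e ≤ cost n m
  ED≤cost (_ , minimal) al with c , es , refl ← alignment⇒edits al = minimal c es

  ED-transport-≤ : (∀ {n m} → Alignment S T n m →
                     ∃ λ n′ → Alignment S′ T′ n′ m × n Nat.+ length S′ ≡ n′ Nat.+ length S) →
                   IsED a S T e → IsED a S′ T′ e′ → e′ + len S ≤ e + len S′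
  ED-transport-≤ {S = S} {S′ = S′} {e = e} {e′ = e′} transport (edits , _) ed′
    with n , m , al , cost≤e ← edits⇒alignment edits
    with n′ , al′ , shift ← transport al
    = begin
      e′ + len S                     ≤⟨ +-monoˡ-≤ (len S) (ED≤cost ed′ al′) ⟩
      cost n′ m + len S              ≡⟨ cost-+ˡ n′ (length S) m ⟨
      cost (n′ Nat.+ length S) m     ≡⟨ cong (λ k → cost k m) shift ⟨
      cost (n Nat.+ length S′) m     ≡⟨ cost-+ˡ n (length S′) m ⟩
      cost n m + len S′              ≤⟨ +-monoˡ-≤ (len S′) cost≤e ⟩
      e + len S′                     ∎
    where open ≤-Reasoning

module _ where
  open import Data.Rational using (_+_; _-_)
  open import Data.Rational.Solver using (module +-*-Solver)
  open +-*-Solver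

  p+s≡q+r⇒p+t-r≡q+t-s : ∀ p q r s t → p + s ≡ q + r → p + t - r ≡ q + t - s
  p+s≡q+r⇒p+t-r≡q+t-s p q r s t eq = begin
    p + t - r              ≡⟨ solve 4 (λ p r s t → p :+ t :- r := (p :+ s) :+ t :- (r :+ s)) refl p r s t ⟩
    (p + s) + t - (r + s)  ≡⟨ cong (λ x → x + t - (r + s)) eq ⟩
    (q + r) + t - (r + s)  ≡⟨ solve 4 (λ q r s t → (q :+ r) :+ t :- (r :+ s) := q :+ t :- s) refl q r s t ⟩
    q + t - s              ∎
    where open ≡-Reasoning

fact22 : {Σ : Set} (a : ℕ) .{{_ : NonZero a}} (X Y L R : List Σ)
  → length L ≥ length Y → length R ≥ length Y
  → (∀ c → c ∈ Y → c ∉ L ++ R)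
  → (e₁ e₂ : ℚ)
  → IsED a (pad X Y) (map just Y) e₁
  → IsED a (L ++ X ++ R) Y e₂
  → Dval (pad X Y) (map just Y) e₁ ≡ Dval (L ++ X ++ R) Y e₂
fact22 a X Y L R Y≤L Y≤R disjoint e₁ e₂ ed₁ ed₂ = begin
  e₁ + len (map just Y) - len (pad X Y)  ≡⟨ cong (λ l → e₁ + fromℕ l - len (pad X Y)) (length-map just Y) ⟩
  e₁ + len Y - len (pad X Y)             ≡⟨ p+s≡q+r⇒p+t-r≡q+t-s e₁ e₂ _ _ (len Y) transport ⟩
  e₂ + len Y - len (L ++ X ++ R)         ∎
  where
  open ≡-Reasoning
  open import Data.Rational using (_+_; _-_)
  open import Data.Rational.Properties using (≤-antisym)
  L∩Y≡∅ : Disjoint L Y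
  L∩Y≡∅ (c∈L , c∈Y) = disjoint _ c∈Y (∈-++⁺ˡ c∈L)
  R∩Y≡∅ : Disjoint R Y
  R∩Y≡∅ (c∈R , c∈Y) = disjoint _ c∈Y (∈-++⁺ʳ L c∈R)
  transport : e₁ + len (L ++ X ++ R) ≡ e₂ + len (pad X Y)
  transport = ≤-antisym (ED-transport-≤ a (frame→pad X Y L R L∩Y≡∅ R∩Y≡∅) ed₂ ed₁)
                        (ED-transport-≤ a (pad→frame X Y L R Y≤L Y≤R) ed₁ ed₂)
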